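{- Let $k>1$ and $\ell>4$ be integers and let $\mathcal L$ be a mixed layout of $G(k,\ell)$ with linear order $\prec$. Then there are no seven vertices $p_1,\dots,p_7$ of $G(k-1,\ell)$ with either $p_1\prec p_2\prec\dots\prec p_7$ or $p_7\prec p_6\prec\dots\prec p_1$ that form any of the following patterns (all listed edges being edges of $G(k-1,\ell)$ of the listed type): (P.1) $(p_1,p_3)$, $(p_1,p_6)$, $(p_4,p_5)$ are stack-edges and $(p_2,p_7)$ is a queue-edge; (P.2) $(p_2,p_3)$, $(p_2,p_6)$, $(p_4,p_5)$ are stack-edges and $(p_1,p_7)$ is a queue-edge; (P.3) $(p_1,p_7)$, $(p_2,p_4)$, $(p_2,p_5)$ are stack-edges and $(p_1,p_6)$, $(p_3,p_7)$ are queue-edges.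
   Context: For $\ell\ge 1$, $G(1,\ell)$ is a single edge; for $k>1$, $G(k,\ell)$ is obtained from $G(k-1,\ell)$ by attaching $\ell$ new vertices to each edge of $G(k-1,\ell)$, where attaching a new vertex $x$ to an edge $(v,w)$ means adding $x$ and the edges $(x,v),(x,w)$. A linear order is a total order $\prec$ of the vertex set. Two independent edges $(u_1,v_1),(u_2,v_2)$ with $u_i\prec v_i$ cross if $u_1\prec u_2\prec v_1\prec v_2$ and nest if $u_1\prec u_2\prec v_2\prec v_1$. A stack is a set of pairwise non-crossing edges; a queue is a set of pairwise non-nested edges. A mixed layout consists of a linear order of the vertices and a partition of the edges into one stack and one queue; edges in the stack (queue) are stack-edges (queue-edges). -}

module Defs where

open import Data.Nat using (ℕ; zero; suc)
open import Data.Fin using (Fin)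
open import Data.Product using (_×_; _,_; proj₁; proj₂; ∃-syntax)
open import Data.Sum using (_⊎_)
open import Level using (0ℓ)
open import Relation.Binary.Core using (Rel)
open import Relation.Binary.Structures using (IsStrictTotalOrder)
open import Relation.Binary.PropositionalEquality using (_≡_)
open import Relation.Nullary using (¬_)

-- The graph G(k, ℓ).  'Vtx ℓ k' are the vertices and 'Edg ℓ k' the edges
-- of G(k, ℓ), indexed with the paper's k (k = 0 gives the empty graph,
-- which is not used).  Vertices/edges of G(k+1, ℓ) that come from
-- G(k, ℓ) are wrapped in 'old'.
data Edg (ℓ : ℕ) : ℕ → Set where
  base : Edg ℓ 1
  old  : ∀ {k} → Edg ℓ (suc k) → Edg ℓ (suc (suc k))
  -- for the i-th new vertex x attached to edge e = (v, w):
  toL  : ∀ {k} → Edg ℓ (suc k) → Fin ℓ → Edg ℓ (suc (suc k))  -- edge (x, v)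
  toR  : ∀ {k} → Edg ℓ (suc k) → Fin ℓ → Edg ℓ (suc (suc k))  -- edge (x, w)

data Vtx (ℓ : ℕ) : ℕ → Set where
  base₀ base₁ : Vtx ℓ 1
  old  : ∀ {k} → Vtx ℓ (suc k) → Vtx ℓ (suc (suc k))
  new  : ∀ {k} → Edg ℓ (suc k) → Fin ℓ → Vtx ℓ (suc (suc k))

ends : ∀ {ℓ k} → Edg ℓ k → Vtx ℓ k × Vtx ℓ k
ends base = base₀ , base₁
ends (old e) = old (proj₁ (ends e)) , old (proj₂ (ends e))
ends (toL e i) = new e i , old (proj₁ (ends e))
ends (toR e i) = new e i , old (proj₂ (ends e))

EndsAre : ∀ {ℓ k} → Edg ℓ k → Vtx ℓ k → Vtx ℓ k → Set
EndsAre e u v = (ends e ≡ (u , v)) ⊎ (ends e ≡ (v , u))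

module _ {ℓ k : ℕ} (_≺_ : Rel (Vtx ℓ k) 0ℓ) where
  -- e = (u₁,v₁), f = (u₂,v₂) with u₁ ≺ u₂ ≺ v₁ ≺ v₂  (forces independence)
  Cross : Edg ℓ k → Edg ℓ k → Set
  Cross e f = ∃[ u₁ ] ∃[ v₁ ] ∃[ u₂ ] ∃[ v₂ ]
    (EndsAre e u₁ v₁ × EndsAre f u₂ v₂ × u₁ ≺ u₂ × u₂ ≺ v₁ × v₁ ≺ v₂)

  Nest : Edg ℓ k → Edg ℓ k → Set
  Nest e f = ∃[ u₁ ] ∃[ v₁ ] ∃[ u₂ ] ∃[ v₂ ]
    (EndsAre e u₁ v₁ × EndsAre f u₂ v₂ × u₁ ≺ u₂ × u₂ ≺ v₂ × v₂ ≺ v₁)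

data Side : Set where
  stack queue : Side

record MixedLayout (ℓ k : ℕ) : Set₁ where
  field
    _≺_     : Rel (Vtx ℓ k) 0ℓ
    isSTO   : IsStrictTotalOrder _≡_ _≺_
    side    : Edg ℓ k → Side
    stackOK : ∀ e f → side e ≡ stack → side f ≡ stack → ¬ Cross _≺_ e f
    queueOK : ∀ e f → side e ≡ queue → side f ≡ queue → ¬ Nest _≺_ e f

module _ {ℓ k : ℕ} (L : MixedLayout ℓ (suc (suc k))) where
  open MixedLayout L

  -- (u, v) is an edge of G(k+1, ℓ) (the "previous" graph) of type s in L
  EdgeOfType : Side → Vtx ℓ (suc k) → Vtx ℓ (suc k) → Set
  EdgeOfType s u v = ∃[ e ] (EndsAre e u v × side (old e) ≡ s)

  module _ (p₁ p₂ p₃ p₄ p₅ p₆ p₇ : Vtx ℓ (suc k)) where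
    Ascending : Set
    Ascending = old p₁ ≺ old p₂ × old p₂ ≺ old p₃ × old p₃ ≺ old p₄ ×
                old p₄ ≺ old p₅ × old p₅ ≺ old p₆ × old p₆ ≺ old p₇

    Descending : Set
    Descending = old p₇ ≺ old p₆ × old p₆ ≺ old p₅ × old p₅ ≺ old p₄ ×
                 old p₄ ≺ old p₃ × old p₃ ≺ old p₂ × old p₂ ≺ old p₁

    P1 : Set
    P1 = EdgeOfType stack p₁ p₃ × EdgeOfType stack p₁ p₆ ×
         EdgeOfType stack p₄ p₅ × EdgeOfType queue p₂ p₇

    P2 : Set
    P2 = EdgeOfType stack p₂ p₃ × EdgeOfType stack p₂ p₆ ×
         EdgeOfType stack p₄ p₅ × EdgeOfType queue p₁ p₇

    P3 : Set
    P3 = EdgeOfType stack p₁ p₇ × EdgeOfType stack p₂ p₄ ×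
         EdgeOfType stack p₂ p₅ × EdgeOfType queue p₁ p₆ ×
         EdgeOfType queue p₃ p₇

-- Let ab, with a ≺ b, be the pattern edge whose attached vertices are used: (p₄, p₅) in
-- P.1 and P.2, (p₂, p₄) in P.3. Each attached vertex x is adjacent to both a and b, and
-- the remaining pattern edges restrict the types of xa and xb, depending on where x lies
-- among p₁, …, p₇, to one of four classes: both queue-edges with x ≺ a, both stack-edges
-- with a ≺ x ≺ b, both queue-edges with b ≺ x, or both stack-edges with x outside [a, b].
-- Two attached vertices of the same class yield two crossing stack-edges or two nested
-- queue-edges, so by pigeonhole at most four vertices can be attached to ab, while ℓ ≥ 5.
-- A descending pattern is an ascending one for the reversed order.
module Submission where

open import Defs
open import Data.Empty using (⊥; ⊥-elim)
open import Data.Fin using (Fin; inject≤) renaming (_<_ to _<ᶠ_)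
open import Data.Fin.Patterns using (0F; 1F; 2F; 3F)
open import Data.Fin.Properties using (pigeonhole; inject≤-injective; <-irrefl)
open import Data.Nat using (ℕ; suc; _<_)
open import Data.Nat.Properties using (n<1+n)
open import Data.Product using (∃; ∃-syntax; _×_; _,_; proj₁; proj₂)
import Data.Product as Product
open import Data.Sum using (_⊎_; inj₁; inj₂; [_,_]; swap)
import Data.Sum as Sum
open import Function using (_∘_; id; flip)
open import Function.Definitions using (Injective)
open import Level using (0ℓ)
open import Relation.Binary.Core using (Rel)
open import Relation.Binary.Definitions using (Symmetric; tri<; tri≈; tri>)
open import Relation.Binary.Structures using (IsStrictTotalOrder)
import Relation.Binary.Construct.Flip.EqAndOrd as Flip
open import Relation.Binary.PropositionalEquality using (_≡_; _≢_; refl; sym; cong; subst)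
open import Relation.Nullary using (¬_)

-- V stands for the vertices of G(k, ℓ) and old embeds those of G(k - 1, ℓ).
module StackQueue {V W : Set} (old : W → V) (Stacked Queued : Rel V 0ℓ)
  (Stacked-sym : Symmetric Stacked) (Queued-sym : Symmetric Queued) where

  Adjacent : Rel V 0ℓ
  Adjacent x y = Stacked x y ⊎ Queued x y

  adjacent⇒stacked : ∀ {x y} → ¬ Queued x y → Adjacent x y → Stacked x y
  adjacent⇒stacked ¬q = [ id , ⊥-elim ∘ ¬q ]

  adjacent⇒queued : ∀ {x y} → ¬ Stacked x y → Adjacent x y → Queued x y
  adjacent⇒queued ¬s = [ ⊥-elim ∘ ¬s , id ]

  ¬adjacent : ∀ {x y} → ¬ Stacked x y → ¬ Queued x y → ¬ Adjacent x y
  ¬adjacent = [_,_]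

  record Fan (a b : V) : Set where
    field
      vertex    : Fin 5 → V
      injective : Injective _≡_ _≡_ vertex
      fresh     : ∀ i w → vertex i ≢ old w
      adjacentˡ : ∀ i → Adjacent (vertex i) a
      adjacentʳ : ∀ i → Adjacent (vertex i) b

  module _ (p₁ p₂ p₃ p₄ p₅ p₆ p₇ : W) where
    FanPattern₁ FanPattern₂ FanPattern₃ : Set
    FanPattern₁ = Stacked (old p₁) (old p₃) × Stacked (old p₁) (old p₆) ×
                  Fan (old p₄) (old p₅) × Queued (old p₂) (old p₇)
    FanPattern₂ = Stacked (old p₂) (old p₃) × Stacked (old p₂) (old p₆) ×
                  Fan (old p₄) (old p₅) × Queued (old p₁) (old p₇)
    FanPattern₃ = Stacked (old p₁) (old p₇) × Fan (old p₂) (old p₄) × Stacked (old p₂) (old p₅) ×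
                  Queued (old p₁) (old p₆) × Queued (old p₃) (old p₇)

    FanPatterns : Set
    FanPatterns = FanPattern₁ ⊎ FanPattern₂ ⊎ FanPattern₃

  StacksDoNotCross : Rel V 0ℓ → Set
  StacksDoNotCross _≺_ = ∀ {u₁ v₁ u₂ v₂} → Stacked u₁ v₁ → Stacked u₂ v₂ →
                         u₁ ≺ u₂ → u₂ ≺ v₁ → v₁ ≺ v₂ → ⊥

  QueuesDoNotNest : Rel V 0ℓ → Set
  QueuesDoNotNest _≺_ = ∀ {u₁ v₁ u₂ v₂} → Queued u₁ v₁ → Queued u₂ v₂ →
                        u₁ ≺ u₂ → u₂ ≺ v₂ → v₂ ≺ v₁ → ⊥

  StacksDoNotCross-flip : ∀ {_≺_} → StacksDoNotCross _≺_ → StacksDoNotCross (flip _≺_)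
  StacksDoNotCross-flip noCross s t u₁≻u₂ u₂≻v₁ v₁≻v₂ =
    noCross (Stacked-sym t) (Stacked-sym s) v₁≻v₂ u₂≻v₁ u₁≻u₂

  QueuesDoNotNest-flip : ∀ {_≺_} → QueuesDoNotNest _≺_ → QueuesDoNotNest (flip _≺_)
  QueuesDoNotNest-flip noNest q r u₁≻u₂ u₂≻v₂ v₂≻v₁ =
    noNest (Queued-sym q) (Queued-sym r) v₂≻v₁ u₂≻v₂ u₁≻u₂

  module Ordered {_≺_ : Rel V 0ℓ} (isStrictTotalOrder : IsStrictTotalOrder _≡_ _≺_)
    (noCross : StacksDoNotCross _≺_) (noNest : QueuesDoNotNest _≺_) where
    open IsStrictTotalOrder isStrictTotalOrder
      using (compare; irrefl) renaming (trans to infixr 5 _⟫_)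

    data Class (a b x : V) : Fin 4 → Set where
      leftQueued   : x ≺ a → Queued x a → Queued x b → Class a b x 0F
      innerStacked : a ≺ x → x ≺ b → Stacked x a → Stacked x b → Class a b x 1F
      rightQueued  : b ≺ x → Queued x a → Queued x b → Class a b x 2F
      leftStacked  : x ≺ a → Stacked x a → Stacked x b → Class a b x 3F
      rightStacked : b ≺ x → Stacked x a → Stacked x b → Class a b x 3F

    ¬sameClass-≺ : ∀ {a b x y c} → a ≺ b → x ≺ y → Class a b x c → Class a b y c → ⊥
    ¬sameClass-≺ a≺b x≺y (leftQueued _ _ qxb) (leftQueued y≺a qya _) =
      noNest qxb qya x≺y y≺a a≺b
    ¬sameClass-≺ a≺b x≺y (innerStacked a≺x _ _ sxb) (innerStacked _ y≺b sya _) =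
      noCross (Stacked-sym sya) sxb a≺x x≺y y≺b
    ¬sameClass-≺ a≺b x≺y (rightQueued b≺x _ qxb) (rightQueued _ qya _) =
      noNest (Queued-sym qya) (Queued-sym qxb) a≺b b≺x x≺y
    ¬sameClass-≺ a≺b x≺y (leftStacked _ sxa _) (leftStacked y≺a _ syb) =
      noCross sxa syb x≺y y≺a a≺b
    ¬sameClass-≺ a≺b x≺y (leftStacked x≺a _ sxb) (rightStacked b≺y sya _) =
      noCross sxb (Stacked-sym sya) x≺a a≺b b≺y
    ¬sameClass-≺ a≺b x≺y (rightStacked b≺x _ _) (leftStacked y≺a _ _) =
      irrefl refl (a≺b ⟫ b≺x ⟫ x≺y ⟫ y≺a)
    ¬sameClass-≺ a≺b x≺y (rightStacked b≺x sxa _) (rightStacked _ _ syb) =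
      noCross (Stacked-sym sxa) (Stacked-sym syb) a≺b b≺x x≺y

    sameClass⇒≡ : ∀ {a b x y c} → a ≺ b → Class a b x c → Class a b y c → x ≡ y
    sameClass⇒≡ {x = x} {y} a≺b cx cy with compare x y
    ... | tri< x≺y _ _ = ⊥-elim (¬sameClass-≺ a≺b x≺y cx cy)
    ... | tri≈ _ x≡y _ = x≡y
    ... | tri> _ _ y≺x = ⊥-elim (¬sameClass-≺ a≺b y≺x cy cx)

    noFan : ∀ {a b} → a ≺ b →
            (∀ {x} → (∀ w → x ≢ old w) →
                     Adjacent x a → Adjacent x b → ∃ (Class a b x)) →
            ¬ Fan a b
    noFan {a} {b} a≺b classify fan = collision (pigeonhole (n<1+n 4) (proj₁ ∘ class))
      where
      open Fan fan
      class : ∀ i → ∃ (Class a b (vertex i))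
      class i = classify (fresh i) (adjacentˡ i) (adjacentʳ i)
      collision : ¬ (∃[ i ] ∃[ j ] (i <ᶠ j × proj₁ (class i) ≡ proj₁ (class j)))
      collision (i , j , i<j , same) = <-irrefl (injective vertexᵢ≡vertexⱼ) i<j
        where
        vertexᵢ≡vertexⱼ : vertex i ≡ vertex j
        vertexᵢ≡vertexⱼ = sameClass⇒≡ a≺b (proj₂ (class i))
                            (subst (Class a b (vertex j)) (sym same) (proj₂ (class j)))

    module _ {p₁ p₂ p₃ p₄ p₅ p₆ p₇ : W}
      (1≺2 : old p₁ ≺ old p₂) (2≺3 : old p₂ ≺ old p₃) (3≺4 : old p₃ ≺ old p₄)
      (4≺5 : old p₄ ≺ old p₅) (5≺6 : old p₅ ≺ old p₆) (6≺7 : old p₆ ≺ old p₇)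
      where

      data Gap (x : V) : Set where
        gap₀ : x ≺ old p₁ → Gap x
        gap₁ : old p₁ ≺ x → x ≺ old p₂ → Gap x
        gap₂ : old p₂ ≺ x → x ≺ old p₃ → Gap x
        gap₃ : old p₃ ≺ x → x ≺ old p₄ → Gap x
        gap₄ : old p₄ ≺ x → x ≺ old p₅ → Gap x
        gap₅ : old p₅ ≺ x → x ≺ old p₆ → Gap x
        gap₆ : old p₆ ≺ x → x ≺ old p₇ → Gap x
        gap₇ : old p₇ ≺ x → Gap x

      locate : ∀ {x} → (∀ w → x ≢ old w) → Gap x
      locate {x} x∉old with compare x (old p₁)
      ... | tri< x≺1 _ _ = gap₀ x≺1
      ... | tri≈ _ x≡1 _ = ⊥-elim (x∉old p₁ x≡1)
      ... | tri> _ _ 1≺x with compare x (old p₂)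
      ...   | tri< x≺2 _ _ = gap₁ 1≺x x≺2
      ...   | tri≈ _ x≡2 _ = ⊥-elim (x∉old p₂ x≡2)
      ...   | tri> _ _ 2≺x with compare x (old p₃)
      ...     | tri< x≺3 _ _ = gap₂ 2≺x x≺3
      ...     | tri≈ _ x≡3 _ = ⊥-elim (x∉old p₃ x≡3)
      ...     | tri> _ _ 3≺x with compare x (old p₄)
      ...       | tri< x≺4 _ _ = gap₃ 3≺x x≺4
      ...       | tri≈ _ x≡4 _ = ⊥-elim (x∉old p₄ x≡4)
      ...       | tri> _ _ 4≺x with compare x (old p₅)
      ...         | tri< x≺5 _ _ = gap₄ 4≺x x≺5
      ...         | tri≈ _ x≡5 _ = ⊥-elim (x∉old p₅ x≡5)
      ...         | tri> _ _ 5≺x with compare x (old p₆)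
      ...           | tri< x≺6 _ _ = gap₅ 5≺x x≺6
      ...           | tri≈ _ x≡6 _ = ⊥-elim (x∉old p₆ x≡6)
      ...           | tri> _ _ 6≺x with compare x (old p₇)
      ...             | tri< x≺7 _ _ = gap₆ 6≺x x≺7
      ...             | tri≈ _ x≡7 _ = ⊥-elim (x∉old p₇ x≡7)
      ...             | tri> _ _ 7≺x = gap₇ 7≺x

      private
        1≺4 : old p₁ ≺ old p₄
        1≺4 = 1≺2 ⟫ 2≺3 ⟫ 3≺4
        1≺5 : old p₁ ≺ old p₅
        1≺5 = 1≺4 ⟫ 4≺5
        2≺4 : old p₂ ≺ old p₄
        2≺4 = 2≺3 ⟫ 3≺4
        2≺5 : old p₂ ≺ old p₅
        2≺5 = 2≺4 ⟫ 4≺5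
        3≺5 : old p₃ ≺ old p₅
        3≺5 = 3≺4 ⟫ 4≺5
        4≺6 : old p₄ ≺ old p₆
        4≺6 = 4≺5 ⟫ 5≺6
        4≺7 : old p₄ ≺ old p₇
        4≺7 = 4≺6 ⟫ 6≺7
        5≺7 : old p₅ ≺ old p₇
        5≺7 = 5≺6 ⟫ 6≺7
        2≺7 : old p₂ ≺ old p₇
        2≺7 = 2≺5 ⟫ 5≺7
        3≺7 : old p₃ ≺ old p₇
        3≺7 = 3≺4 ⟫ 4≺7

      classify₁ : Stacked (old p₁) (old p₃) → Stacked (old p₁) (old p₆) →
                  Queued (old p₂) (old p₇) →
                  ∀ {x} → Gap x → Adjacent x (old p₄) → Adjacent x (old p₅) →
                  ∃ (Class (old p₄) (old p₅) x)
      classify₁ s₁₃ s₁₆ q₂₇ (gap₀ x≺1) a₄ a₅ = _ , leftQueued (x≺1 ⟫ 1≺4)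
        (adjacent⇒queued (λ s → noCross s s₁₆ x≺1 1≺4 4≺6) a₄)
        (adjacent⇒queued (λ s → noCross s s₁₆ x≺1 1≺5 5≺6) a₅)
      classify₁ s₁₃ s₁₆ q₂₇ (gap₁ 1≺x x≺2) a₄ a₅ = _ , leftQueued (x≺2 ⟫ 2≺4)
        (adjacent⇒queued (λ s → noCross s₁₃ s 1≺x (x≺2 ⟫ 2≺3) 3≺4) a₄)
        (adjacent⇒queued (λ s → noCross s₁₃ s 1≺x (x≺2 ⟫ 2≺3) 3≺5) a₅)
      classify₁ s₁₃ s₁₆ q₂₇ (gap₂ 2≺x x≺3) a₄ a₅ = ⊥-elim (¬adjacent
        (λ s → noCross s₁₃ s (1≺2 ⟫ 2≺x) x≺3 3≺4)
        (λ q → noNest q₂₇ q 2≺x (x≺3 ⟫ 3≺4) 4≺7) a₄)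
      classify₁ s₁₃ s₁₆ q₂₇ (gap₃ 3≺x x≺4) a₄ a₅ = _ , leftStacked x≺4
        (adjacent⇒stacked (λ q → noNest q₂₇ q (2≺3 ⟫ 3≺x) x≺4 4≺7) a₄)
        (adjacent⇒stacked (λ q → noNest q₂₇ q (2≺3 ⟫ 3≺x) (x≺4 ⟫ 4≺5) 5≺7) a₅)
      classify₁ s₁₃ s₁₆ q₂₇ (gap₄ 4≺x x≺5) a₄ a₅ = _ , innerStacked 4≺x x≺5
        (adjacent⇒stacked (λ q → noNest q₂₇ (Queued-sym q) 2≺4 4≺x (x≺5 ⟫ 5≺7)) a₄)
        (adjacent⇒stacked (λ q → noNest q₂₇ q (2≺4 ⟫ 4≺x) x≺5 5≺7) a₅)
      classify₁ s₁₃ s₁₆ q₂₇ (gap₅ 5≺x x≺6) a₄ a₅ = _ , rightStacked 5≺x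
        (adjacent⇒stacked (λ q → noNest q₂₇ (Queued-sym q) 2≺4 (4≺5 ⟫ 5≺x) (x≺6 ⟫ 6≺7)) a₄)
        (adjacent⇒stacked (λ q → noNest q₂₇ (Queued-sym q) 2≺5 5≺x (x≺6 ⟫ 6≺7)) a₅)
      classify₁ s₁₃ s₁₆ q₂₇ (gap₆ 6≺x x≺7) a₄ a₅ = ⊥-elim (¬adjacent
        (λ s → noCross s₁₆ (Stacked-sym s) 1≺4 4≺6 6≺x)
        (λ q → noNest q₂₇ (Queued-sym q) 2≺4 (4≺6 ⟫ 6≺x) x≺7) a₄)
      classify₁ s₁₃ s₁₆ q₂₇ (gap₇ 7≺x) a₄ a₅ = _ , rightQueued (5≺7 ⟫ 7≺x)
        (adjacent⇒queued (λ s → noCross s₁₆ (Stacked-sym s) 1≺4 4≺6 (6≺7 ⟫ 7≺x)) a₄)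
        (adjacent⇒queued (λ s → noCross s₁₆ (Stacked-sym s) 1≺5 5≺6 (6≺7 ⟫ 7≺x)) a₅)

      classify₂ : Stacked (old p₂) (old p₃) → Stacked (old p₂) (old p₆) →
                  Queued (old p₁) (old p₇) →
                  ∀ {x} → Gap x → Adjacent x (old p₄) → Adjacent x (old p₅) →
                  ∃ (Class (old p₄) (old p₅) x)
      classify₂ s₂₃ s₂₆ q₁₇ (gap₀ x≺1) a₄ a₅ = _ , leftQueued (x≺1 ⟫ 1≺4)
        (adjacent⇒queued (λ s → noCross s s₂₆ (x≺1 ⟫ 1≺2) 2≺4 4≺6) a₄)
        (adjacent⇒queued (λ s → noCross s s₂₆ (x≺1 ⟫ 1≺2) 2≺5 5≺6) a₅)
      classify₂ s₂₃ s₂₆ q₁₇ (gap₁ 1≺x x≺2) a₄ a₅ = ⊥-elim (¬adjacent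
        (λ s → noCross s s₂₆ x≺2 2≺4 4≺6)
        (λ q → noNest q₁₇ q 1≺x (x≺2 ⟫ 2≺4) 4≺7) a₄)
      classify₂ s₂₃ s₂₆ q₁₇ (gap₂ 2≺x x≺3) a₄ a₅ = ⊥-elim (¬adjacent
        (λ s → noCross s₂₃ s 2≺x x≺3 3≺4)
        (λ q → noNest q₁₇ q (1≺2 ⟫ 2≺x) (x≺3 ⟫ 3≺4) 4≺7) a₄)
      classify₂ s₂₃ s₂₆ q₁₇ (gap₃ 3≺x x≺4) a₄ a₅ = _ , leftStacked x≺4
        (adjacent⇒stacked (λ q → noNest q₁₇ q (1≺2 ⟫ 2≺3 ⟫ 3≺x) x≺4 4≺7) a₄)
        (adjacent⇒stacked (λ q → noNest q₁₇ q (1≺2 ⟫ 2≺3 ⟫ 3≺x) (x≺4 ⟫ 4≺5) 5≺7) a₅)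
      classify₂ s₂₃ s₂₆ q₁₇ (gap₄ 4≺x x≺5) a₄ a₅ = _ , innerStacked 4≺x x≺5
        (adjacent⇒stacked (λ q → noNest q₁₇ (Queued-sym q) 1≺4 4≺x (x≺5 ⟫ 5≺7)) a₄)
        (adjacent⇒stacked (λ q → noNest q₁₇ q (1≺4 ⟫ 4≺x) x≺5 5≺7) a₅)
      classify₂ s₂₃ s₂₆ q₁₇ (gap₅ 5≺x x≺6) a₄ a₅ = _ , rightStacked 5≺x
        (adjacent⇒stacked (λ q → noNest q₁₇ (Queued-sym q) 1≺4 (4≺5 ⟫ 5≺x) (x≺6 ⟫ 6≺7)) a₄)
        (adjacent⇒stacked (λ q → noNest q₁₇ (Queued-sym q) 1≺5 5≺x (x≺6 ⟫ 6≺7)) a₅)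
      classify₂ s₂₃ s₂₆ q₁₇ (gap₆ 6≺x x≺7) a₄ a₅ = ⊥-elim (¬adjacent
        (λ s → noCross s₂₆ (Stacked-sym s) 2≺4 4≺6 6≺x)
        (λ q → noNest q₁₇ (Queued-sym q) 1≺4 (4≺6 ⟫ 6≺x) x≺7) a₄)
      classify₂ s₂₃ s₂₆ q₁₇ (gap₇ 7≺x) a₄ a₅ = _ , rightQueued (5≺7 ⟫ 7≺x)
        (adjacent⇒queued (λ s → noCross s₂₆ (Stacked-sym s) 2≺4 4≺6 (6≺7 ⟫ 7≺x)) a₄)
        (adjacent⇒queued (λ s → noCross s₂₆ (Stacked-sym s) 2≺5 5≺6 (6≺7 ⟫ 7≺x)) a₅)

      classify₃ : Stacked (old p₁) (old p₇) → Stacked (old p₂) (old p₅) →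
                  Queued (old p₁) (old p₆) → Queued (old p₃) (old p₇) →
                  ∀ {x} → Gap x → Adjacent x (old p₂) → Adjacent x (old p₄) →
                  ∃ (Class (old p₂) (old p₄) x)
      classify₃ s₁₇ s₂₅ q₁₆ q₃₇ (gap₀ x≺1) a₂ a₄ = _ , leftQueued (x≺1 ⟫ 1≺2)
        (adjacent⇒queued (λ s → noCross s s₁₇ x≺1 1≺2 2≺7) a₂)
        (adjacent⇒queued (λ s → noCross s s₁₇ x≺1 1≺4 4≺7) a₄)
      classify₃ s₁₇ s₂₅ q₁₆ q₃₇ (gap₁ 1≺x x≺2) a₂ a₄ = ⊥-elim (¬adjacent
        (λ s → noCross s s₂₅ x≺2 2≺4 4≺5)
        (λ q → noNest q₁₆ q 1≺x (x≺2 ⟫ 2≺4) 4≺6) a₄)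
      classify₃ s₁₇ s₂₅ q₁₆ q₃₇ (gap₂ 2≺x x≺3) a₂ a₄ = _ , innerStacked 2≺x (x≺3 ⟫ 3≺4)
        (adjacent⇒stacked (λ q → noNest q₁₆ (Queued-sym q) 1≺2 2≺x (x≺3 ⟫ 3≺4 ⟫ 4≺6)) a₂)
        (adjacent⇒stacked (λ q → noNest q₁₆ q (1≺2 ⟫ 2≺x) (x≺3 ⟫ 3≺4) 4≺6) a₄)
      classify₃ s₁₇ s₂₅ q₁₆ q₃₇ (gap₃ 3≺x x≺4) a₂ a₄ = _ , innerStacked (2≺3 ⟫ 3≺x) x≺4
        (adjacent⇒stacked (λ q → noNest q₁₆ (Queued-sym q) 1≺2 (2≺3 ⟫ 3≺x) (x≺4 ⟫ 4≺6)) a₂)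
        (adjacent⇒stacked (λ q → noNest q₁₆ q (1≺2 ⟫ 2≺3 ⟫ 3≺x) x≺4 4≺6) a₄)
      classify₃ s₁₇ s₂₅ q₁₆ q₃₇ (gap₄ 4≺x x≺5) a₂ a₄ = _ , rightStacked 4≺x
        (adjacent⇒stacked (λ q → noNest q₁₆ (Queued-sym q) 1≺2 (2≺4 ⟫ 4≺x) (x≺5 ⟫ 5≺6)) a₂)
        (adjacent⇒stacked (λ q → noNest q₁₆ (Queued-sym q) 1≺4 4≺x (x≺5 ⟫ 5≺6)) a₄)
      classify₃ s₁₇ s₂₅ q₁₆ q₃₇ (gap₅ 5≺x x≺6) a₂ a₄ = ⊥-elim (¬adjacent
        (λ s → noCross s₂₅ (Stacked-sym s) 2≺4 4≺5 5≺x)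
        (λ q → noNest q₁₆ (Queued-sym q) 1≺4 (4≺5 ⟫ 5≺x) x≺6) a₄)
      classify₃ s₁₇ s₂₅ q₁₆ q₃₇ (gap₆ 6≺x x≺7) a₂ a₄ = ⊥-elim (¬adjacent
        (λ s → noCross s₂₅ (Stacked-sym s) 2≺4 4≺5 (5≺6 ⟫ 6≺x))
        (λ q → noNest q₃₇ (Queued-sym q) 3≺4 (4≺6 ⟫ 6≺x) x≺7) a₄)
      classify₃ s₁₇ s₂₅ q₁₆ q₃₇ (gap₇ 7≺x) a₂ a₄ = ⊥-elim (¬adjacent
        (λ s → noCross s₁₇ (Stacked-sym s) 1≺2 2≺7 7≺x)
        (λ q → noNest (Queued-sym q) q₃₇ 2≺3 3≺7 7≺x) a₂)

      noFanPattern : ¬ FanPatterns p₁ p₂ p₃ p₄ p₅ p₆ p₇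
      noFanPattern (inj₁ (s₁₃ , s₁₆ , fan , q₂₇)) =
        noFan 4≺5 (classify₁ s₁₃ s₁₆ q₂₇ ∘ locate) fan
      noFanPattern (inj₂ (inj₁ (s₂₃ , s₂₆ , fan , q₁₇))) =
        noFan 4≺5 (classify₂ s₂₃ s₂₆ q₁₇ ∘ locate) fan
      noFanPattern (inj₂ (inj₂ (s₁₇ , fan , s₂₅ , q₁₆ , q₃₇))) =
        noFan 2≺4 (classify₃ s₁₇ s₂₅ q₁₆ q₃₇ ∘ locate) fan

module Layout {ℓ k : ℕ} (4<ℓ : 4 < ℓ) (L : MixedLayout ℓ (suc (suc k))) where
  open MixedLayout L

  OnSide : Side → Rel (Vtx ℓ (suc (suc k))) 0ℓ
  OnSide s u v = ∃[ f ] (EndsAre f u v × side f ≡ s)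

  OnSide-sym : ∀ s → Symmetric (OnSide s)
  OnSide-sym s (f , uv , f-side) = f , swap uv , f-side

  open StackQueue old (OnSide stack) (OnSide queue) (OnSide-sym stack) (OnSide-sym queue)

  noCross : StacksDoNotCross _≺_
  noCross (e , ends-e , e-side) (f , ends-f , f-side) u₁≺u₂ u₂≺v₁ v₁≺v₂ =
    stackOK e f e-side f-side (_ , _ , _ , _ , ends-e , ends-f , u₁≺u₂ , u₂≺v₁ , v₁≺v₂)

  noNest : QueuesDoNotNest _≺_
  noNest (e , ends-e , e-side) (f , ends-f , f-side) u₁≺u₂ u₂≺v₂ v₂≺v₁ =
    queueOK e f e-side f-side (_ , _ , _ , _ , ends-e , ends-f , u₁≺u₂ , u₂≺v₂ , v₂≺v₁)

  module Forward = Ordered isSTO noCross noNest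
  module Backward = Ordered (Flip.isStrictTotalOrder isSTO)
    (StacksDoNotCross-flip noCross) (QueuesDoNotNest-flip noNest)

  EndsAre-old : ∀ {e : Edg ℓ (suc k)} {u v} → EndsAre e u v → EndsAre (old e) (old u) (old v)
  EndsAre-old = Sum.map (cong (Product.map old old)) (cong (Product.map old old))

  lift : ∀ {s u v} → EdgeOfType L s u v → OnSide s (old u) (old v)
  lift (e , uv , e-side) = old e , EndsAre-old uv , e-side

  edge-adjacent : ∀ f {u v} → EndsAre f u v → Adjacent u v
  edge-adjacent f uv with side f in f-side
  ... | stack = inj₁ (f , uv , f-side)
  ... | queue = inj₂ (f , uv , f-side)

  attached-adjacent : ∀ {e : Edg ℓ (suc k)} i {a b} → EndsAre e a b → Adjacent (new e i) (old a)
  attached-adjacent {e} i (inj₁ eq) =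
    edge-adjacent (toL e i) (inj₁ (cong (λ (v , _) → new e i , old v) eq))
  attached-adjacent {e} i (inj₂ eq) =
    edge-adjacent (toR e i) (inj₁ (cong (λ (_ , w) → new e i , old w) eq))

  new-injective : ∀ {e : Edg ℓ (suc k)} {i j} → new e i ≡ new e j → i ≡ j
  new-injective refl = refl

  fanOf : ∀ (e : Edg ℓ (suc k)) {a b} → EndsAre e a b → Fan (old a) (old b)
  fanOf e ab = record
    { vertex    = λ i → new e (inject≤ i 4<ℓ)
    ; injective = inject≤-injective _ _ _ _ ∘ new-injective
    ; fresh     = λ _ _ ()
    ; adjacentˡ = λ _ → attached-adjacent _ ab
    ; adjacentʳ = λ _ → attached-adjacent _ (swap ab)
    }

  toFanPattern : ∀ {p₁ p₂ p₃ p₄ p₅ p₆ p₇} →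
    P1 L p₁ p₂ p₃ p₄ p₅ p₆ p₇ ⊎ P2 L p₁ p₂ p₃ p₄ p₅ p₆ p₇ ⊎
    P3 L p₁ p₂ p₃ p₄ p₅ p₆ p₇ → FanPatterns p₁ p₂ p₃ p₄ p₅ p₆ p₇
  toFanPattern (inj₁ (s₁₃ , s₁₆ , (e , ends , _) , q₂₇)) =
    inj₁ (lift s₁₃ , lift s₁₆ , fanOf e ends , lift q₂₇)
  toFanPattern (inj₂ (inj₁ (s₂₃ , s₂₆ , (e , ends , _) , q₁₇))) =
    inj₂ (inj₁ (lift s₂₃ , lift s₂₆ , fanOf e ends , lift q₁₇))
  toFanPattern (inj₂ (inj₂ (s₁₇ , (e , ends , _) , s₂₅ , q₁₆ , q₃₇))) =
    inj₂ (inj₂ (lift s₁₇ , fanOf e ends , lift s₂₅ , lift q₁₆ , lift q₃₇))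

  noOrderedFanPattern : ∀ {p₁ p₂ p₃ p₄ p₅ p₆ p₇} →
    Ascending L p₁ p₂ p₃ p₄ p₅ p₆ p₇ ⊎ Descending L p₁ p₂ p₃ p₄ p₅ p₆ p₇ →
    ¬ FanPatterns p₁ p₂ p₃ p₄ p₅ p₆ p₇
  noOrderedFanPattern (inj₁ (1≺2 , 2≺3 , 3≺4 , 4≺5 , 5≺6 , 6≺7)) =
    Forward.noFanPattern 1≺2 2≺3 3≺4 4≺5 5≺6 6≺7
  noOrderedFanPattern (inj₂ (7≺6 , 6≺5 , 5≺4 , 4≺3 , 3≺2 , 2≺1)) =
    Backward.noFanPattern 2≺1 3≺2 4≺3 5≺4 6≺5 7≺6

lemma5 : (j ℓ : ℕ) → 4 < ℓ → (L : MixedLayout ℓ (suc (suc j))) →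
    (p₁ p₂ p₃ p₄ p₅ p₆ p₇ : Vtx ℓ (suc j)) →
    ¬ ((Ascending L p₁ p₂ p₃ p₄ p₅ p₆ p₇ ⊎ Descending L p₁ p₂ p₃ p₄ p₅ p₆ p₇) ×
    (P1 L p₁ p₂ p₃ p₄ p₅ p₆ p₇ ⊎ P2 L p₁ p₂ p₃ p₄ p₅ p₆ p₇ ⊎ P3 L p₁ p₂ p₃ p₄ p₅ p₆ p₇))
lemma5 j ℓ 4<ℓ L p₁ p₂ p₃ p₄ p₅ p₆ p₇ (ordered , occurrence) =
  noOrderedFanPattern ordered (toFanPattern occurrence)
  where open Layout 4<ℓ L
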